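{- Let $n,\alpha$ be integers with $n\ge 7$ and $2\le\alpha\le n$. Then \[ \frac{f_{\sf T}(n,\alpha)}{\alpha-1}\le\frac{2^n}{n-1}. \]
   Context: For integers $1\le\alpha\le n$, $f_{\sf T}(n,\alpha)$ is the number of stable sets (including the empty set) of the Turán graph $T_{n,\alpha}$, the disjoint union of $\alpha$ cliques whose orders sum to $n$ and differ pairwise by at most one; explicitly $f_{\sf T}(n,\alpha)=(\lceil n/\alpha\rceil+1)^p(\lfloor n/\alpha\rfloor+1)^{\alpha-p}$ with $p=n\bmod\alpha$. -}

module Defs where

open import Data.Nat using (ℕ; suc; _+_; _^_; _*_; NonZero)
open import Data.Nat.DivMod using (_/_; _%_)

⌈_/_⌉ : (n α : ℕ) → .{{_ : NonZero α}} → ℕ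
⌈ n / α ⌉ = (n + α Data.Nat.∸ 1) / α

-- f_T(n, α) = (⌈n/α⌉+1)^p (⌊n/α⌋+1)^(α-p), p = n mod α:
-- the number of stable sets (incl. empty) of the Turán graph T_{n,α}
fT : (n α : ℕ) → .{{_ : NonZero α}} → ℕ
fT n α = (suc ⌈ n / α ⌉) ^ (n % α) * (suc (n / α)) ^ (α Data.Nat.∸ (n % α))

module Submission where

-- Write n = qα + p with q = ⌊n/α⌋ ≥ 1 and p = n mod α, and put t = α − p ≥ 1.  The Turán
-- graph T_{n,α} consists of p cliques of order q+1 and t cliques of order q, so
-- f_T(n,α) ≤ (q+2)^p (q+1)^t, while 2ⁿ = (2^q)^t (2^{q+1})^p is the same product taken over
-- all vertex subsets.  It therefore suffices to prove, for every such clique profile,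
--        (q+2)^p (q+1)^t (n−1) ≤ 2ⁿ (α−1).                                        (★)
-- The clique ratio (s+1)/2^s equals 1 for s = 1, so (★) has to be argued separately
-- according to q:
--   q = 1:  reduces to 3^p (p+a) ≤ 4^p a with a = α−1 ≥ 3, a Bernoulli-type estimate;
--   q = 2:  reduces to 3^t (n−1) ≤ 2^p 4^t (α−1), split on t = 1 and t ≥ 2;
--   q ≥ 3:  (q+2)^p (q+1)^t ≤ 2^p (q+1)^α and n−1 ≤ (2q+1)(α−1) reduce (★) to the growth
--           estimate (q+1)^α (2q+1) ≤ (2^q)^α, valid except for q = 3, α = 2 (i.e. n = 7),
--           which is checked directly.

open import Data.Nat
open import Data.Nat.Properties
open import Data.Nat.DivMod
open import Data.Nat.Tactic.RingSolver using (solve-∀)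
open import Data.Product using (_×_; _,_)
open import Data.Sum using (_⊎_; inj₁; inj₂)
open import Relation.Binary.PropositionalEquality
open import Relation.Nullary using (contradiction)
open import Relation.Nullary.Decidable using (from-yes; from-no)
open import Defs

open ≤-Reasoning

-- An inequality witnessed by an explicit difference; pairs with the ring solver, which
-- proves the defining equation.
≤-by : ∀ {a b} c → a + c ≡ b → a ≤ b
≤-by {a} c refl = m≤m+n a c

^-distribʳ-* : ∀ x y n → (x * y) ^ n ≡ x ^ n * y ^ n
^-distribʳ-* x y zero    = refl
^-distribʳ-* x y (suc n) = begin-equality
  x * y * (x * y) ^ n      ≡⟨ cong (x * y *_) (^-distribʳ-* x y n) ⟩
  x * y * (x ^ n * y ^ n)  ≡⟨ regroup x y (x ^ n) (y ^ n) ⟩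
  x * x ^ n * (y * y ^ n)  ∎
  where regroup : ∀ x y u v → x * y * (u * v) ≡ x * u * (y * v)
        regroup = solve-∀

^-ratio-mono : ∀ {x y c d m m′} → x ≤ y → m ≤ m′ → x ^ m * c ≤ y ^ m * d → x ^ m′ * c ≤ y ^ m′ * d
^-ratio-mono {x} {y} {c} {d} {m} x≤y m≤m′ base = go (≤⇒≤′ m≤m′)
  where
    go : ∀ {k} → m ≤′ k → x ^ k * c ≤ y ^ k * d
    go ≤′-refl           = base
    go (≤′-step {k} m≤k) = begin
      x * x ^ k * c    ≡⟨ *-assoc x (x ^ k) c ⟩
      x * (x ^ k * c)  ≤⟨ *-mono-≤ x≤y (go m≤k) ⟩
      y * (y ^ k * d)  ≡⟨ *-assoc y (y ^ k) d ⟨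
      y * y ^ k * d    ∎

-- Bernoulli's inequality in integral form: (1 + 1/b)^p ≥ 1 + p/b.
bernoulli : ∀ b p → b ^ p * (b + p) ≤ b * suc b ^ p
bernoulli b zero    = ≤-reflexive (base b)
  where base : ∀ b → 1 * (b + 0) ≡ b * 1
        base = solve-∀
bernoulli b (suc p) = begin
  b * b ^ p * (b + suc p)    ≡⟨ regroup b (b ^ p) p ⟩
  b ^ p * (b * (b + suc p))  ≤⟨ *-monoʳ-≤ (b ^ p) (≤-by p (step b p)) ⟩
  b ^ p * (suc b * (b + p))  ≡⟨ regroup′ b (b ^ p) p ⟩
  suc b * (b ^ p * (b + p))  ≤⟨ *-monoʳ-≤ (suc b) (bernoulli b p) ⟩
  suc b * (b * suc b ^ p)    ≡⟨ regroup″ b (suc b ^ p) ⟩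
  b * (suc b * suc b ^ p)    ∎
  where
    regroup : ∀ b x p → b * x * (b + suc p) ≡ x * (b * (b + suc p))
    regroup = solve-∀
    step : ∀ b p → b * (b + suc p) + p ≡ suc b * (b + p)
    step = solve-∀
    regroup′ : ∀ b x p → x * (suc b * (b + p)) ≡ suc b * (x * (b + p))
    regroup′ = solve-∀
    regroup″ : ∀ b y → suc b * (b * y) ≡ b * (suc b * y)
    regroup″ = solve-∀

suc≤2^ : ∀ q → suc q ≤ 2 ^ q
suc≤2^ q = begin
  suc q            ≡⟨ *-identityʳ (suc q) ⟨
  suc q * 1        ≡⟨ cong (suc q *_) (^-zeroˡ q) ⟨
  suc q * 1 ^ q    ≡⟨ *-comm (suc q) (1 ^ q) ⟩
  1 ^ q * (1 + q)  ≤⟨ bernoulli 1 q ⟩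
  1 * 2 ^ q        ≡⟨ *-identityˡ (2 ^ q) ⟩
  2 ^ q            ∎

cubic≤4^ : ∀ k → (5 + k) * (5 + k) * (9 + 2 * k) ≤ 4 ^ (4 + k)
cubic≤4^ zero    = from-yes (225 ≤? 256)
cubic≤4^ (suc k) = begin
  (5 + suc k) * (5 + suc k) * (9 + 2 * suc k) ≤⟨ ≤-by (504 + 356 * k + 81 * k * k + 6 * k * k * k) (step k) ⟩
  4 * ((5 + k) * (5 + k) * (9 + 2 * k)) ≤⟨ *-monoʳ-≤ 4 (cubic≤4^ k) ⟩
  4 * 4 ^ (4 + k)                       ∎
  where
    step : ∀ k → (5 + suc k) * (5 + suc k) * (9 + 2 * suc k) + (504 + 356 * k + 81 * k * k + 6 * k * k * k)
                 ≡ 4 * ((5 + k) * (5 + k) * (9 + 2 * k))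
    step = solve-∀

2^-profile : ∀ q t p → 2 ^ (q * (t + p) + p) ≡ (2 ^ q) ^ t * (2 ^ suc q) ^ p
2^-profile q t p = begin-equality
  2 ^ (q * (t + p) + p)          ≡⟨ cong (2 ^_) (regroup q t p) ⟩
  2 ^ (q * t + suc q * p)        ≡⟨ ^-distribˡ-+-* 2 (q * t) (suc q * p) ⟩
  2 ^ (q * t) * 2 ^ (suc q * p)  ≡⟨ cong₂ _*_ (^-*-assoc 2 q t) (^-*-assoc 2 (suc q) p) ⟨
  (2 ^ q) ^ t * (2 ^ suc q) ^ p  ∎
  where regroup : ∀ q t p → q * (t + p) + p ≡ q * t + suc q * p
        regroup = solve-∀

⌈/⌉≤1+/ : ∀ n α .{{_ : NonZero α}} → ⌈ n / α ⌉ ≤ suc (n / α)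
⌈/⌉≤1+/ n α = begin
  (n + α ∸ 1) / α        ≤⟨ /-monoˡ-≤ α (m∸n≤m (n + α) 1) ⟩
  (n + α) / α            ≡⟨ m/n≡1+[m∸n]/n (m≤n+m α n) ⟩
  suc ((n + α ∸ α) / α)  ≡⟨ cong (λ m → suc (m / α)) (m+n∸n≡m n α) ⟩
  suc (n / α)            ∎

fT-bound : ∀ n α .{{_ : NonZero α}} → fT n α ≤ (2 + n / α) ^ (n % α) * (1 + n / α) ^ (α ∸ n % α)
fT-bound n α = *-monoˡ-≤ _ (^-monoˡ-≤ (n % α) (s≤s (⌈/⌉≤1+/ n α)))

pred-vertex-bound : ∀ q a p → p ≤ a → 1 ≤ a → q * suc a + p ∸ 1 ≤ (1 + 2 * q) * a
pred-vertex-bound q (suc b) p p≤a _ = m≤n+o⇒m∸n≤o (q * suc (suc b) + p) 1 (begin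
  q * (2 + b) + p      ≤⟨ +-monoʳ-≤ (q * (2 + b)) p≤a ⟩
  q * (2 + b) + suc b  ≤⟨ ≤-by (1 + q * b) (expand q b) ⟩
  1 + (1 + 2 * q) * suc b ∎)
  where expand : ∀ q b → q * (2 + b) + suc b + (1 + q * b) ≡ 1 + (1 + 2 * q) * suc b
        expand = solve-∀

growth-3 : ∀ α → 3 ≤ α → 4 ^ α * 7 ≤ 8 ^ α
growth-3 α 3≤α = begin
  4 ^ α * 7  ≤⟨ ^-ratio-mono {4} {8} {7} {1} (from-yes (4 ≤? 8)) 3≤α (from-yes (448 ≤? 512)) ⟩
  8 ^ α * 1  ≡⟨ *-identityʳ (8 ^ α) ⟩
  8 ^ α      ∎

growth-4+ : ∀ k α → 2 ≤ α → (5 + k) ^ α * (1 + 2 * (4 + k)) ≤ (2 ^ (4 + k)) ^ α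
growth-4+ k α 2≤α = begin
  (5 + k) ^ α * (1 + 2 * q)  ≤⟨ ^-ratio-mono (suc≤2^ q) 2≤α base ⟩
  (2 ^ q) ^ α * 1            ≡⟨ *-identityʳ ((2 ^ q) ^ α) ⟩
  (2 ^ q) ^ α                ∎
  where
    q = 4 + k
    square : ∀ x c → x * x * c ≡ x * (x * 1) * c
    square = solve-∀
    4^≡[2^]² : 4 ^ q ≡ (2 ^ q) ^ 2 * 1
    4^≡[2^]² = begin-equality
      (2 ^ 2) ^ q      ≡⟨ ^-*-assoc 2 2 q ⟩
      2 ^ (2 * q)      ≡⟨ cong (2 ^_) (*-comm 2 q) ⟩
      2 ^ (q * 2)      ≡⟨ ^-*-assoc 2 q 2 ⟨
      (2 ^ q) ^ 2      ≡⟨ *-identityʳ _ ⟨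
      (2 ^ q) ^ 2 * 1  ∎
    base : (5 + k) ^ 2 * (1 + 2 * q) ≤ (2 ^ q) ^ 2 * 1
    base = begin
      (5 + k) ^ 2 * (1 + 2 * q)        ≡⟨ square (5 + k) (1 + 2 * q) ⟨
      (5 + k) * (5 + k) * (1 + 2 * q)  ≡⟨ cong ((5 + k) * (5 + k) *_) (linear k) ⟩
      (5 + k) * (5 + k) * (9 + 2 * k)  ≤⟨ cubic≤4^ k ⟩
      4 ^ q                            ≡⟨ 4^≡[2^]² ⟩
      (2 ^ q) ^ 2 * 1                  ∎
      where linear : ∀ k → 1 + 2 * (4 + k) ≡ 9 + 2 * k
            linear = solve-∀

-- (★) for any q, provided the growth estimate holds for q and α: bound each clique of
-- order q+1 by twice one of order q, and n − 1 by (2q+1)(α − 1).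
bound-from-growth : ∀ q {p t α n} → 1 ≤ t → 2 ≤ α → t + p ≡ α → q * α + p ≡ n →
  (1 + q) ^ α * (1 + 2 * q) ≤ (2 ^ q) ^ α →
  (2 + q) ^ p * (1 + q) ^ t * (n ∸ 1) ≤ 2 ^ n * (α ∸ 1)
bound-from-growth q {p} {suc u} _ (s≤s 1≤a) refl refl growth = begin
  (2 + q) ^ p * (1 + q) ^ t * (n ∸ 1)       ≤⟨ *-mono-≤ clique-factors
                                                 (pred-vertex-bound q a p (m≤n+m p u) 1≤a) ⟩
  2 ^ p * (1 + q) ^ α * ((1 + 2 * q) * a)   ≡⟨ regroup (2 ^ p) ((1 + q) ^ α) (1 + 2 * q) a ⟩
  2 ^ p * ((1 + q) ^ α * (1 + 2 * q)) * a   ≤⟨ *-monoˡ-≤ a (*-monoʳ-≤ (2 ^ p) growth) ⟩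
  2 ^ p * (2 ^ q) ^ α * a                   ≡⟨ cong (_* a) 2^n-split ⟨
  2 ^ n * a                                 ∎
  where
    t = suc u
    a = u + p
    α = t + p
    n = q * α + p
    regroup : ∀ x y z a → x * y * (z * a) ≡ x * (y * z) * a
    regroup = solve-∀
    clique-factors : (2 + q) ^ p * (1 + q) ^ t ≤ 2 ^ p * (1 + q) ^ α
    clique-factors = begin
      (2 + q) ^ p * (1 + q) ^ t              ≤⟨ *-monoˡ-≤ _ (^-monoˡ-≤ p (≤-by q (double q))) ⟩
      (2 * (1 + q)) ^ p * (1 + q) ^ t        ≡⟨ cong (_* (1 + q) ^ t) (^-distribʳ-* 2 (1 + q) p) ⟩
      2 ^ p * (1 + q) ^ p * (1 + q) ^ t      ≡⟨ regroup′ (2 ^ p) ((1 + q) ^ p) ((1 + q) ^ t) ⟩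
      2 ^ p * ((1 + q) ^ t * (1 + q) ^ p)    ≡⟨ cong (2 ^ p *_) (^-distribˡ-+-* (1 + q) t p) ⟨
      2 ^ p * (1 + q) ^ α                    ∎
      where double : ∀ q → 2 + q + q ≡ 2 * (1 + q)
            double = solve-∀
            regroup′ : ∀ x y z → x * y * z ≡ x * (z * y)
            regroup′ = solve-∀
    2^n-split : 2 ^ n ≡ 2 ^ p * (2 ^ q) ^ α
    2^n-split = begin-equality
      2 ^ (q * α + p)      ≡⟨ ^-distribˡ-+-* 2 (q * α) p ⟩
      2 ^ (q * α) * 2 ^ p  ≡⟨ cong (_* 2 ^ p) (^-*-assoc 2 q α) ⟨
      (2 ^ q) ^ α * 2 ^ p  ≡⟨ *-comm ((2 ^ q) ^ α) (2 ^ p) ⟩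
      2 ^ p * (2 ^ q) ^ α  ∎

-- For q = 3 the growth estimate fails only at α = 2, which with n ≥ 7 forces t = p = 1.
q3-exception : ∀ p t → 1 ≤ t → 7 ≤ 3 * (t + p) + p → 3 ≤ t + p ⊎ (t ≡ 1 × p ≡ 1)
q3-exception zero          (suc zero)          _ h = contradiction h (from-no (7 ≤? 3))
q3-exception zero          (suc (suc zero))    _ h = contradiction h (from-no (7 ≤? 6))
q3-exception zero          (suc (suc (suc t))) _ _ = inj₁ (s≤s (s≤s (s≤s z≤n)))
q3-exception (suc zero)    (suc zero)          _ _ = inj₂ (refl , refl)
q3-exception (suc zero)    (suc (suc t))       _ _ = inj₁ (s≤s (s≤s (m≤n+m 1 t)))
q3-exception (suc (suc p)) (suc t)             _ _ = inj₁ (s≤s (≤-trans (s≤s (s≤s z≤n)) (m≤n+m (2 + p) t)))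

-- (★) for q = 1 reduces to this: 3^p (p+a) ≤ 4^p a whenever a ≥ 3, by Bernoulli with b = 3.
edge-bound : ∀ p a → 3 ≤ a → 3 ^ p * (p + a) ≤ 4 ^ p * a
edge-bound p a 3≤a = *-cancelˡ-≤ 3 (begin
  3 * (3 ^ p * (p + a))      ≡⟨ regroup (3 ^ p) p a ⟩
  3 ^ p * (p * 3 + 3 * a)    ≤⟨ *-monoʳ-≤ (3 ^ p) (+-monoˡ-≤ (3 * a) (*-monoʳ-≤ p 3≤a)) ⟩
  3 ^ p * (p * a + 3 * a)    ≡⟨ regroup′ (3 ^ p) p a ⟩
  3 ^ p * (3 + p) * a        ≤⟨ *-monoˡ-≤ a (bernoulli 3 p) ⟩
  3 * 4 ^ p * a              ≡⟨ *-assoc 3 (4 ^ p) a ⟩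
  3 * (4 ^ p * a)            ∎)
  where
    regroup : ∀ x p a → 3 * (x * (p + a)) ≡ x * (p * 3 + 3 * a)
    regroup = solve-∀
    regroup′ : ∀ x p a → x * (p * a + 3 * a) ≡ x * (3 + p) * a
    regroup′ = solve-∀

profile-q1 : ∀ {p t α n} → 1 ≤ t → 7 ≤ n → t + p ≡ α → 1 * α + p ≡ n →
  3 ^ p * 2 ^ t * (n ∸ 1) ≤ 2 ^ n * (α ∸ 1)
profile-q1 {p} {suc u} _ h7 refl refl = begin
  3 ^ p * 2 ^ t * (1 * (t + p) + p ∸ 1) ≡⟨ regroup (3 ^ p) (2 ^ t) u p ⟩
  2 ^ t * (3 ^ p * (p + a))     ≤⟨ *-monoʳ-≤ (2 ^ t) (edge-bound p a 3≤a) ⟩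
  2 ^ t * (4 ^ p * a)           ≡⟨ *-assoc (2 ^ t) (4 ^ p) a ⟨
  2 ^ t * 4 ^ p * a             ≡⟨ cong (_* a) (2^-profile 1 t p) ⟨
  2 ^ (1 * (t + p) + p) * a     ∎
  where
    t = suc u
    a = u + p
    regroup : ∀ x y u p → x * y * (u + p + 0 + p) ≡ y * (x * (p + (u + p)))
    regroup = solve-∀
    -- n = α + p ≥ 7 and p < α force a = α − 1 ≥ 3.
    3≤a : 3 ≤ a
    3≤a = *-cancelˡ-≤ 2 (begin
      6            ≤⟨ s≤s⁻¹ h7 ⟩
      a + 0 + p    ≡⟨ cong (_+ p) (+-identityʳ a) ⟩
      a + p        ≤⟨ +-monoʳ-≤ a (m≤n+m p u) ⟩
      a + a        ≡⟨ cong (a +_) (+-identityʳ a) ⟨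
      2 * a        ∎)

-- (★) for q = 2 with at least two cliques of order 2 (t ≥ 2), after cancelling 4^p and
-- bounding n − 1 by 3(α − 1): the factor 3^t·3 is beaten by 2^p 4^t.
pairs-wide : ∀ p t → 2 ≤ t → 7 ≤ 2 * (t + p) + p → 3 ^ t * 3 ≤ 2 ^ p * 4 ^ t
pairs-wide zero (suc zero)             (s≤s ()) _
pairs-wide zero (suc (suc zero))       _ h = contradiction h (from-no (7 ≤? 4))
pairs-wide zero (suc (suc (suc zero))) _ h = contradiction h (from-no (7 ≤? 6))
pairs-wide zero t@(suc (suc (suc (suc _)))) _ _ = begin
  3 ^ t * 3  ≤⟨ ^-ratio-mono {3} {4} {3} {1} {4} {t} (from-yes (3 ≤? 4)) (s≤s (s≤s (s≤s (s≤s z≤n)))) (from-yes (243 ≤? 256)) ⟩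
  4 ^ t * 1  ≡⟨ *-comm (4 ^ t) 1 ⟩
  1 * 4 ^ t  ∎
pairs-wide (suc p) t 2≤t _ = begin
  3 ^ t * 3        ≤⟨ ^-ratio-mono {3} {4} {3} {2} (from-yes (3 ≤? 4)) 2≤t (from-yes (27 ≤? 32)) ⟩
  4 ^ t * 2        ≤⟨ *-monoʳ-≤ (4 ^ t) (^-monoʳ-≤ 2 (s≤s (z≤n {p}))) ⟩
  4 ^ t * 2 ^ suc p ≡⟨ *-comm (4 ^ t) (2 ^ suc p) ⟩
  2 ^ suc p * 4 ^ t ∎

-- (★) for q = 2 after cancelling 4^p: 3^t (n−1) ≤ 2^p 4^t (α−1), where n = 2α + p.
pairs-bound : ∀ p t → 1 ≤ t → 7 ≤ 2 * (t + p) + p →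
  3 ^ t * (2 * (t + p) + p ∸ 1) ≤ 2 ^ p * 4 ^ t * (t + p ∸ 1)
pairs-bound zero          (suc zero) _ h = contradiction h (from-no (7 ≤? 2))
pairs-bound (suc zero)    (suc zero) _ h = contradiction h (from-no (7 ≤? 5))
pairs-bound p@(suc (suc k)) (suc zero) _ _ = begin
  3 ^ 1 * (2 * (1 + p) + p ∸ 1)  ≤⟨ ≤-by (11 + 7 * k) (linear k) ⟩
  2 ^ 2 * 4 ^ 1 * p              ≤⟨ *-monoˡ-≤ p (*-monoˡ-≤ (4 ^ 1) (^-monoʳ-≤ 2 (s≤s (s≤s (z≤n {k}))))) ⟩
  2 ^ p * 4 ^ 1 * p              ∎
  where linear : ∀ k → 3 * 1 * ((2 + k) + suc ((2 + k) + 0) + (2 + k)) + (11 + 7 * k) ≡ 16 * (2 + k)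
        linear = solve-∀
pairs-bound p t@(suc (suc w)) _ h7 = begin
  3 ^ t * (n ∸ 1)       ≤⟨ *-monoʳ-≤ (3 ^ t) (m≤n+o⇒m∸n≤o n 1 (≤-by w (linear w p))) ⟩
  3 ^ t * (3 * a)       ≡⟨ *-assoc (3 ^ t) 3 a ⟨
  3 ^ t * 3 * a         ≤⟨ *-monoˡ-≤ a (pairs-wide p t (s≤s (s≤s z≤n)) h7) ⟩
  2 ^ p * 4 ^ t * a     ∎
  where
    n = 2 * (t + p) + p
    a = suc (w + p)
    linear : ∀ w p → 2 * (2 + w + p) + p + w ≡ 1 + 3 * (1 + w + p)
    linear = solve-∀

profile-q2 : ∀ {p t α n} → 1 ≤ t → 7 ≤ n → t + p ≡ α → 2 * α + p ≡ n →
  4 ^ p * 3 ^ t * (n ∸ 1) ≤ 2 ^ n * (α ∸ 1)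
profile-q2 {p} {t} 1≤t h7 refl refl = begin
  4 ^ p * 3 ^ t * (n ∸ 1)    ≡⟨ *-assoc (4 ^ p) (3 ^ t) (n ∸ 1) ⟩
  4 ^ p * (3 ^ t * (n ∸ 1))  ≤⟨ *-monoʳ-≤ (4 ^ p) (pairs-bound p t 1≤t h7) ⟩
  4 ^ p * (2 ^ p * 4 ^ t * a) ≡⟨ regroup (4 ^ p) (2 ^ p) (4 ^ t) a ⟩
  4 ^ t * (2 ^ p * 4 ^ p) * a ≡⟨ cong (λ z → 4 ^ t * z * a) (^-distribʳ-* 2 4 p) ⟨
  4 ^ t * 8 ^ p * a          ≡⟨ cong (_* a) (2^-profile 2 t p) ⟨
  2 ^ n * a                  ∎
  where
    n = 2 * (t + p) + p
    a = t + p ∸ 1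
    regroup : ∀ x y z a → x * (y * z * a) ≡ z * (y * x) * a
    regroup = solve-∀

clique-profile-bound : ∀ q {p t α n} → 1 ≤ q → 1 ≤ t → 2 ≤ α → 7 ≤ n → t + p ≡ α → q * α + p ≡ n →
  (2 + q) ^ p * (1 + q) ^ t * (n ∸ 1) ≤ 2 ^ n * (α ∸ 1)
clique-profile-bound zero () _ _ _ _ _
clique-profile-bound 1 _ 1≤t _ h7 eqα eqn = profile-q1 1≤t h7 eqα eqn
clique-profile-bound 2 _ 1≤t _ h7 eqα eqn = profile-q2 1≤t h7 eqα eqn
clique-profile-bound 3 {p} {t} _ 1≤t 2≤α h7 refl refl with q3-exception p t 1≤t h7
... | inj₁ 3≤α          = bound-from-growth 3 1≤t 2≤α refl refl (growth-3 (t + p) 3≤α)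
... | inj₂ (refl , refl) = from-yes (120 ≤? 128)
clique-profile-bound q@(suc (suc (suc (suc k)))) {α = α} _ 1≤t 2≤α _ eqα eqn =
  bound-from-growth q 1≤t 2≤α eqα eqn (growth-4+ k α 2≤α)

lemma9 : (n α : ℕ) → 7 ≤ n → 2 ≤ α → α ≤ n →
    .{{_ : NonZero α}} →
    fT n α * (n ∸ 1) ≤ 2 ^ n * (α ∸ 1)
lemma9 n α 7≤n 2≤α α≤n = begin
  fT n α * (n ∸ 1)                     ≤⟨ *-monoˡ-≤ (n ∸ 1) (fT-bound n α) ⟩
  (2 + q) ^ p * (1 + q) ^ t * (n ∸ 1)  ≤⟨ clique-profile-bound q (m≥n⇒m/n>0 α≤n) (m<n⇒0<n∸m p<α)
                                           2≤α 7≤n (m∸n+n≡m (<⇒≤ p<α)) division ⟩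
  2 ^ n * (α ∸ 1)                      ∎
  where
    p = n % α
    q = n / α
    t = α ∸ p
    p<α : p < α
    p<α = m%n<n n α
    division : q * α + p ≡ n
    division = sym (trans (m≡m%n+[m/n]*n n α) (+-comm p (q * α)))
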